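{- Let $G=(V,E,w)$ be a directed graph with positive integer vertex weights, and let $G'=(V',E',w')$ be the undirected graph with $V'=V_{\mathrm{out}}\cup V_{\mathrm{in}}$ (two disjoint copies $\{v_{\mathrm{out}}:v\in V\}$ and $\{v_{\mathrm{in}}:v\in V\}$ of $V$), whose edges are a clique on $V_{\mathrm{out}}$, a clique on $V_{\mathrm{in}}$, the edges $\{v_{\mathrm{out}},v_{\mathrm{in}}\}$ for $v\in V$, and the edges $\{u_{\mathrm{out}},v_{\mathrm{in}}\}$ for $(u,v)\in E$, with weights $w'(v_{\mathrm{out}})=w'(v_{\mathrm{in}})=w(v)$. Then for all $s,t\in V$, $\kappa_G(s,\ast)=\kappa_{G'}(s_{\mathrm{out}})-w(V)$ and $\kappa_G(\ast,t)=\kappa_{G'}(t_{\mathrm{in}})-w(V)$.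
   Context: A vertex cut of a directed graph is a tripartition $(L,S,R)$ of the vertex set with $L,R$ nonempty and no edge $(u,v)$ with $u\in L$, $v\in R$; for an undirected graph, no edge between $L$ and $R$. Its weight is $w(S)=\sum_{v\in S}w(v)$. For a directed graph $G$: $\kappa_G(s,\ast)$ is the minimum weight of a vertex cut with $s\in L$, and $\kappa_G(\ast,t)$ the minimum weight of a vertex cut with $t\in R$. For an undirected graph $G'$ and a vertex $v$, $\kappa_{G'}(v)$ is the minimum weight of a vertex cut with $v\in L$ (equivalently, with $v$ on one of the two sides). A minimum over an empty set of cuts is $\infty$. $w(V)=\sum_{v\in V}w(v)$. -}

module Defs where

open import Data.Nat using (ℕ; zero; suc; _+_; _<_; _⊓_)
open import Data.Bool using (Bool; true; false; _∧_; _∨_; not; if_then_else_)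
open import Data.Fin using (Fin; zero; suc; _↑ˡ_; _↑ʳ_; splitAt)
open import Data.Fin.Properties using (_≟_)
open import Data.List using (List; []; _∷_; map; concatMap; allFin)
open import Data.Bool.ListAction using (any; all)
open import Data.Sum using (inj₁; inj₂)
open import Relation.Nullary.Decidable using (isYes)

-- Extended naturals (∞ = minimum over the empty set)

data ℕ∞ : Set where
  fin : ℕ → ℕ∞
  ∞   : ℕ∞

min∞ : ℕ∞ → ℕ∞ → ℕ∞
min∞ (fin a) (fin b) = fin (a ⊓ b)
min∞ (fin a) ∞       = fin a
min∞ ∞       y       = y

_+∞_ : ℕ∞ → ℕ → ℕ∞
fin a +∞ k = fin (a + k)
∞     +∞ k = ∞

-- A directed graph: E u v = true iff (u,v) is an edge.
-- An undirected graph: E u v = true iff {u,v} is an edge (E symmetric).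

Adj : ℕ → Set
Adj m = Fin m → Fin m → Bool

sumFin : {m : ℕ} → (Fin m → ℕ) → ℕ
sumFin {zero}  f = 0
sumFin {suc m} f = f zero + sumFin (λ i → f (suc i))

-- Tripartitions (L,S,R) of Fin m, encoded as a side-assignment.

data Side : Set where
  L S R : Side

isL isS isR : Side → Bool
isL L = true
isL _ = false
isS S = true
isS _ = false
isR R = true
isR _ = false

anyV : {m : ℕ} → (Fin m → Bool) → Bool
anyV {m} p = any p (allFin m)

allV : {m : ℕ} → (Fin m → Bool) → Bool
allV {m} p = all p (allFin m)

isDirCut : {m : ℕ} → Adj m → (Fin m → Side) → Bool
isDirCut E f =
  anyV (λ u → isL (f u)) ∧ anyV (λ v → isR (f v)) ∧
  allV (λ u → allV (λ v → not (isL (f u) ∧ isR (f v) ∧ E u v)))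

isUndCut : {m : ℕ} → Adj m → (Fin m → Side) → Bool
isUndCut E f =
  anyV (λ u → isL (f u)) ∧ anyV (λ v → isR (f v)) ∧
  allV (λ u → allV (λ v → not (isL (f u) ∧ isR (f v) ∧ (E u v ∨ E v u))))

cutWeight : {m : ℕ} → (Fin m → ℕ) → (Fin m → Side) → ℕ
cutWeight w f = sumFin (λ v → if isS (f v) then w v else 0)

cons : {m : ℕ} → Side → (Fin m → Side) → (Fin (suc m) → Side)
cons s f zero    = s
cons s f (suc i) = f i

assignments : (m : ℕ) → List (Fin m → Side)
assignments zero    = (λ ()) ∷ []
assignments (suc m) = concatMap (λ f → map (λ s → cons s f) (L ∷ S ∷ R ∷ [])) (assignments m)

minCut : {m : ℕ} → (Fin m → ℕ) → ((Fin m → Side) → Bool) → ℕ∞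
minCut {m} w P = go (assignments m)
  where
  go : List (Fin m → Side) → ℕ∞
  go []       = ∞
  go (f ∷ fs) = if P f then min∞ (fin (cutWeight w f)) (go fs) else go fs

-- κ_G(s,∗): min weight of a directed vertex cut with s ∈ L.
κsrc : {m : ℕ} → Adj m → (Fin m → ℕ) → Fin m → ℕ∞
κsrc E w s = minCut w (λ f → isDirCut E f ∧ isL (f s))

-- κ_G(∗,t): min weight of a directed vertex cut with t ∈ R.
κsnk : {m : ℕ} → Adj m → (Fin m → ℕ) → Fin m → ℕ∞
κsnk E w t = minCut w (λ f → isDirCut E f ∧ isR (f t))

-- κ_{G'}(v): min weight of an undirected vertex cut with v ∈ L.
κund : {m : ℕ} → Adj m → (Fin m → ℕ) → Fin m → ℕ∞
κund E w v = minCut w (λ f → isUndCut E f ∧ isL (f v))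

vout : {n : ℕ} → Fin n → Fin (n + n)
vout {n} v = v ↑ˡ n

vin : {n : ℕ} → Fin n → Fin (n + n)
vin {n} v = n ↑ʳ v

eqB : {n : ℕ} → Fin n → Fin n → Bool
eqB u v = isYes (u ≟ v)

splitAdj : {n : ℕ} → Adj n → Adj (n + n)
splitAdj {n} E x y with splitAt n x | splitAt n y
... | inj₁ u | inj₁ v = not (eqB u v)          -- clique on V_out
... | inj₂ u | inj₂ v = not (eqB u v)          -- clique on V_in
... | inj₁ u | inj₂ v = eqB u v ∨ E u v        -- {u_out,u_in}, {u_out,v_in} for (u,v) ∈ E
... | inj₂ u | inj₁ v = eqB v u ∨ E v u

splitW : {n : ℕ} → (Fin n → ℕ) → Fin (n + n) → ℕ
splitW {n} w x with splitAt n x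
... | inj₁ u = w u
... | inj₂ u = w u

{-# OPTIONS --safe #-}
module Submission where

-- A directed cut (L, S, R) of G of weight w(S) yields the cut (L_out, V′ ∖ (L_out ∪ R_in), R_in) of G′
-- of weight w(S) + w(V): it separates because u_out v_in is an edge only if u = v or (u, v) ∈ E.
-- Conversely, in a cut of G′ neither clique meets both L and R. Once s_out ∈ L (or t_in ∈ R) this
-- forces V_out ⊆ L ∪ S and V_in ⊆ S ∪ R, and the edges v_out v_in make such a cut the image of the
-- directed cut ({v | v_out ∈ L}, rest, {v | v_in ∈ R}). For t_in, first exchange L and R, which
-- preserves undirected cuts.

open import Defs
open import Data.Nat using (ℕ; zero; suc; _+_; _≤_; _<_)
open import Data.Nat.Properties
  using (⊓-sel; m⊓n≤m; m⊓n≤n; ≤-refl; ≤-trans; ≤-antisym; ≤-reflexive; +-monoˡ-≤; +-identityʳ; +-assoc;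
         +-commutativeSemigroup)
open import Algebra.Properties.CommutativeSemigroup +-commutativeSemigroup using (interchange)
open import Data.Bool using (Bool; true; false; T; not; _∧_; _∨_; if_then_else_)
open import Data.Bool.Properties using (T-∧; T-∨; T-≡; ∨-comm; ∨-idem)
open import Data.Bool.ListAction using (and; or)
open import Data.Fin using (Fin; zero; suc; _↑ˡ_; _↑ʳ_; splitAt)
open import Data.Fin.Properties using (_≟_; splitAt-↑ˡ; splitAt-↑ʳ; splitAt⁻¹-↑ˡ; splitAt⁻¹-↑ʳ)
open import Data.List using (List; []; _∷_; allFin)
open import Data.List.Properties using (map-cong)
open import Data.List.Membership.Propositional using (_∈_; lose)
open import Data.List.Membership.Propositional.Properties using (∈-allFin; ∈-map⁺; ∈-concat⁺′)
open import Data.List.Relation.Unary.Any using (here; there; satisfied)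
open import Data.List.Relation.Unary.Any.Properties using (any⁺; any⁻)
open import Data.List.Relation.Unary.All.Properties using (all⁺; all⁻)
import Data.List.Relation.Unary.All as All
open import Data.Product using (_×_; _,_; ∃-syntax)
import Data.Product as Product
open import Data.Sum using (_⊎_; inj₁; inj₂; [_,_]′)
import Data.Sum as Sum
open import Function using (_∘_; _⇔_; mk⇔; Equivalence)
open import Relation.Binary.Core using (_Preserves_⟶_)
open import Relation.Binary.PropositionalEquality
  using (_≡_; _≢_; _≗_; refl; sym; trans; cong; cong₂; subst; module ≡-Reasoning)
open import Relation.Nullary using (¬_; yes; no; contradiction)
open import Relation.Nullary.Decidable using (toWitness; fromWitness; fromWitnessFalse)

open Equivalence using (to; from)

private
  variable
    m n : ℕ

anyV-cong : {p q : Fin m → Bool} → p ≗ q → anyV p ≡ anyV q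
anyV-cong {m} p≗q = cong or (map-cong p≗q (allFin m))

allV-cong : {p q : Fin m → Bool} → p ≗ q → allV p ≡ allV q
allV-cong {m} p≗q = cong and (map-cong p≗q (allFin m))

T-anyV : {p : Fin m → Bool} → T (anyV p) ⇔ (∃[ x ] T (p x))
T-anyV {m} {p} = mk⇔ (satisfied ∘ any⁻ p (allFin m)) (λ (x , px) → any⁺ p (lose (∈-allFin x) px))

T-allV : {p : Fin m → Bool} → T (allV p) ⇔ (∀ x → T (p x))
T-allV {m} {p} = mk⇔ (λ h x → All.lookup (all⁺ p (allFin m) h) (∈-allFin x))
                     (λ h → all⁻ p (All.tabulate {xs = allFin m} (λ {x} _ → h x)))

sumFin-cong : sumFin {m} Preserves _≗_ ⟶ _≡_
sumFin-cong {zero}  f≗g = refl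
sumFin-cong {suc m} f≗g = cong₂ _+_ (f≗g zero) (sumFin-cong (f≗g ∘ suc))

sumFin-distrib-+ : (f g : Fin m → ℕ) → sumFin (λ i → f i + g i) ≡ sumFin f + sumFin g
sumFin-distrib-+ {zero}  f g = refl
sumFin-distrib-+ {suc m} f g = begin
  (f zero + g zero) + sumFin (λ i → f (suc i) + g (suc i))
    ≡⟨ cong ((f zero + g zero) +_) (sumFin-distrib-+ (f ∘ suc) (g ∘ suc)) ⟩
  (f zero + g zero) + (sumFin (f ∘ suc) + sumFin (g ∘ suc))
    ≡⟨ interchange (f zero) (g zero) _ _ ⟩
  (f zero + sumFin (f ∘ suc)) + (g zero + sumFin (g ∘ suc)) ∎
  where open ≡-Reasoning

sumFin-↑ : (a b : ℕ) (h : Fin (a + b) → ℕ) →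
  sumFin h ≡ sumFin (λ i → h (i ↑ˡ b)) + sumFin (λ j → h (a ↑ʳ j))
sumFin-↑ zero    b h = refl
sumFin-↑ (suc a) b h = trans (cong (h zero +_) (sumFin-↑ a b (h ∘ suc))) (sym (+-assoc (h zero) _ _))

T-isL : {a : Side} → T (isL a) ⇔ a ≡ L
T-isL {L} = mk⇔ (λ _ → refl) _
T-isL {S} = mk⇔ (λ ()) (λ ())
T-isL {R} = mk⇔ (λ ()) (λ ())

T-isR : {a : Side} → T (isR a) ⇔ a ≡ R
T-isR {L} = mk⇔ (λ ()) (λ ())
T-isR {S} = mk⇔ (λ ()) (λ ())
T-isR {R} = mk⇔ (λ _ → refl) _

T-not-LR : {a b : Side} {e : Bool} → T (not (isL a ∧ isR b ∧ e)) ⇔ (a ≡ L → b ≡ R → ¬ T e)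
T-not-LR {L} {R} {true}  = mk⇔ (λ ()) (λ h → h refl refl _)
T-not-LR {L} {R} {false} = mk⇔ (λ _ _ _ ()) _
T-not-LR {L} {L}         = mk⇔ (λ _ _ ()) _
T-not-LR {L} {S}         = mk⇔ (λ _ _ ()) _
T-not-LR {S}             = mk⇔ (λ _ ()) _
T-not-LR {R}             = mk⇔ (λ _ ()) _

sideWeight : Side → ℕ → ℕ
sideWeight a k = if isS a then k else 0

swapSide : Side → Side
swapSide L = R
swapSide S = S
swapSide R = L

swapSide-involutive : (a : Side) → swapSide (swapSide a) ≡ a
swapSide-involutive L = refl
swapSide-involutive S = refl
swapSide-involutive R = refl

swapSide≡⇒≡swapSide : {a b : Side} → swapSide a ≡ b → a ≡ swapSide b
swapSide≡⇒≡swapSide {a} refl = sym (swapSide-involutive a)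

isL-swapSide : (a : Side) → isL (swapSide a) ≡ isR a
isL-swapSide L = refl
isL-swapSide S = refl
isL-swapSide R = refl

isR-swapSide : (a : Side) → isR (swapSide a) ≡ isL a
isR-swapSide L = refl
isR-swapSide S = refl
isR-swapSide R = refl

sideWeight-swapSide : (a : Side) (k : ℕ) → sideWeight (swapSide a) k ≡ sideWeight a k
sideWeight-swapSide L k = refl
sideWeight-swapSide S k = refl
sideWeight-swapSide R k = refl

outSide inSide : Side → Side
outSide L = L
outSide _ = S
inSide R = R
inSide _ = S

mergeSide : Side → Side → Side
mergeSide L b = L
mergeSide S b = inSide b
mergeSide R b = inSide b

outSide≡L⇒≡L : {a : Side} → outSide a ≡ L → a ≡ L
outSide≡L⇒≡L {L} _ = refl
outSide≡L⇒≡L {S} ()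
outSide≡L⇒≡L {R} ()

inSide≡R⇒≡R : {a : Side} → inSide a ≡ R → a ≡ R
inSide≡R⇒≡R {L} ()
inSide≡R⇒≡R {S} ()
inSide≡R⇒≡R {R} _ = refl

outSide≢R : (a : Side) → outSide a ≢ R
outSide≢R L ()
outSide≢R S ()
outSide≢R R ()

inSide≢L : (a : Side) → inSide a ≢ L
inSide≢L L ()
inSide≢L S ()
inSide≢L R ()

isL-outSide : (a : Side) → isL (outSide a) ≡ isL a
isL-outSide L = refl
isL-outSide S = refl
isL-outSide R = refl

isR-inSide : (a : Side) → isR (inSide a) ≡ isR a
isR-inSide L = refl
isR-inSide S = refl
isR-inSide R = refl

sideWeight-outSide-inSide : (a : Side) (k : ℕ) →
  sideWeight (outSide a) k + sideWeight (inSide a) k ≡ sideWeight a k + k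
sideWeight-outSide-inSide L k = refl
sideWeight-outSide-inSide S k = refl
sideWeight-outSide-inSide R k = +-identityʳ k

outSide-mergeSide : {a : Side} (b : Side) → a ≢ R → outSide (mergeSide a b) ≡ a
outSide-mergeSide {L} b _   = refl
outSide-mergeSide {S} L _   = refl
outSide-mergeSide {S} S _   = refl
outSide-mergeSide {S} R _   = refl
outSide-mergeSide {R} b a≢R = contradiction refl a≢R

inSide-mergeSide : (a : Side) {b : Side} → b ≢ L → (a ≡ L → b ≢ R) → inSide (mergeSide a b) ≡ b
inSide-mergeSide a {L} b≢L _    = contradiction refl b≢L
inSide-mergeSide L {S} _   _    = refl
inSide-mergeSide S {S} _   _    = refl
inSide-mergeSide R {S} _   _    = refl
inSide-mergeSide L {R} _   L↛R = contradiction refl (L↛R refl)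
inSide-mergeSide S {R} _   _    = refl
inSide-mergeSide R {R} _   _    = refl

record IsCut (E : Adj m) (f : Fin m → Side) : Set where
  field
    left      : ∃[ u ] f u ≡ L
    right     : ∃[ v ] f v ≡ R
    separated : ∀ {u v} → f u ≡ L → f v ≡ R → ¬ T (E u v)

T-isDirCut : {E : Adj m} {f : Fin m → Side} → T (isDirCut E f) ⇔ IsCut E f
T-isDirCut {E = E} {f} = mk⇔ reflect reify
  where
  reflect : T (isDirCut E f) → IsCut E f
  reflect h =
    let hL , hR∧sep = to T-∧ h
        hR , hsep   = to T-∧ hR∧sep
    in record
      { left      = Product.map₂ (to T-isL) (to T-anyV hL)
      ; right     = Product.map₂ (to T-isR) (to T-anyV hR)
      ; separated = λ {u} {v} → to T-not-LR (to T-allV (to T-allV hsep u) v)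
      }
  reify : IsCut E f → T (isDirCut E f)
  reify c = from T-∧ (from T-anyV (Product.map₂ (from T-isL) left) ,
            from T-∧ (from T-anyV (Product.map₂ (from T-isR) right) ,
                      from T-allV (λ u → from T-allV (λ v → from T-not-LR (separated {u} {v})))))
    where open IsCut c

symmetrise : Adj m → Adj m
symmetrise E u v = E u v ∨ E v u

-- isUndCut E is definitionally isDirCut (symmetrise E).
T-isUndCut : (E : Adj m) {f : Fin m → Side} → T (isUndCut E f) ⇔ IsCut (symmetrise E) f
T-isUndCut E = T-isDirCut

isDirCut-cong : (E : Adj m) → isDirCut E Preserves _≗_ ⟶ _≡_
isDirCut-cong E f≗g =
  cong₂ _∧_ (anyV-cong (cong isL ∘ f≗g))
    (cong₂ _∧_ (anyV-cong (cong isR ∘ f≗g))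
      (allV-cong λ u → allV-cong λ v →
        cong₂ (λ a b → not (isL a ∧ isR b ∧ E u v)) (f≗g u) (f≗g v)))

∧-preserves-≗ : {C D : (Fin m → Side) → Bool} → C Preserves _≗_ ⟶ _≡_ → D Preserves _≗_ ⟶ _≡_ →
  (λ f → C f ∧ D f) Preserves _≗_ ⟶ _≡_
∧-preserves-≗ C-cong D-cong f≗g = cong₂ _∧_ (C-cong f≗g) (D-cong f≗g)

at-preserves-≗ : (side : Side → Bool) (x : Fin m) → (λ f → side (f x)) Preserves _≗_ ⟶ _≡_
at-preserves-≗ side x f≗g = cong side (f≗g x)

swap-isCut : (E : Adj m) {g : Fin m → Side} →
  IsCut (symmetrise E) g → IsCut (symmetrise E) (swapSide ∘ g)
swap-isCut E c = record
  { left      = Product.map₂ (cong swapSide) right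
  ; right     = Product.map₂ (cong swapSide) left
  ; separated = λ {u} {v} u∈L v∈R uv →
      separated (swapSide≡⇒≡swapSide v∈R) (swapSide≡⇒≡swapSide u∈L)
                (subst T (∨-comm (E u v) (E v u)) uv)
  }
  where open IsCut c

L≢R : L ≢ R
L≢R ()

clique-not-LR : {k : ℕ} {E : Adj m} {g : Fin m → Side} {c : Fin k → Fin m} → IsCut E g →
  (∀ {u v} → u ≢ v → T (E (c u) (c v))) → ∀ {u v} → g (c u) ≡ L → g (c v) ≢ R
clique-not-LR cut clique {u} {v} u∈L v∈R with u ≟ v
... | yes refl = L≢R (trans (sym u∈L) v∈R)
... | no u≢v   = IsCut.separated cut u∈L v∈R (clique u≢v)

cutWeight-cong : (w : Fin m → ℕ) → cutWeight w Preserves _≗_ ⟶ _≡_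
cutWeight-cong w f≗g = sumFin-cong (λ v → cong (λ a → sideWeight a (w v)) (f≗g v))

-- Minimum cuts

infix 4 _≤∞_

data _≤∞_ : ℕ∞ → ℕ∞ → Set where
  fin≤fin : {a b : ℕ} → a ≤ b → fin a ≤∞ fin b
  _≤∞∞    : (x : ℕ∞) → x ≤∞ ∞

≤∞-trans : {x y z : ℕ∞} → x ≤∞ y → y ≤∞ z → x ≤∞ z
≤∞-trans (fin≤fin a≤b) (fin≤fin b≤c) = fin≤fin (≤-trans a≤b b≤c)
≤∞-trans x≤y           (_ ≤∞∞)       = _ ≤∞∞

≤∞-antisym : {x y : ℕ∞} → x ≤∞ y → y ≤∞ x → x ≡ y
≤∞-antisym (fin≤fin a≤b) (fin≤fin b≤a) = cong fin (≤-antisym a≤b b≤a)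
≤∞-antisym (∞ ≤∞∞)       _             = refl

min∞-≤ˡ : (a : ℕ) (y : ℕ∞) → min∞ (fin a) y ≤∞ fin a
min∞-≤ˡ a (fin b) = fin≤fin (m⊓n≤m a b)
min∞-≤ˡ a ∞       = fin≤fin ≤-refl

min∞-≤ʳ : (a : ℕ) (y : ℕ∞) → min∞ (fin a) y ≤∞ y
min∞-≤ʳ a (fin b) = fin≤fin (m⊓n≤n a b)
min∞-≤ʳ a ∞       = _ ≤∞∞

min∞-sel : (a : ℕ) (y : ℕ∞) → min∞ (fin a) y ≡ fin a ⊎ min∞ (fin a) y ≡ y
min∞-sel a (fin b) = Sum.map (cong fin) (cong fin) (⊓-sel a b)
min∞-sel a ∞       = inj₁ refl

+∞-identityʳ : (x : ℕ∞) → x +∞ 0 ≡ x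
+∞-identityʳ (fin a) = cong fin (+-identityʳ a)
+∞-identityʳ ∞       = refl

+∞-monoˡ-≤ : {x : ℕ∞} {b : ℕ} (c : ℕ) → x ≤∞ fin b → x +∞ c ≤∞ fin (b + c)
+∞-monoˡ-≤ c (fin≤fin a≤b) = fin≤fin (+-monoˡ-≤ c a≤b)

minOver : (Fin m → ℕ) → ((Fin m → Side) → Bool) → List (Fin m → Side) → ℕ∞
minOver w P []       = ∞
minOver w P (f ∷ fs) = if P f then min∞ (fin (cutWeight w f)) (minOver w P fs) else minOver w P fs

minOver-unique : (w : Fin m → ℕ) (P : (Fin m → Side) → Bool) (F : List (Fin m → Side) → ℕ∞) →
  F [] ≡ ∞ → (∀ f fs → F (f ∷ fs) ≡ (if P f then min∞ (fin (cutWeight w f)) (F fs) else F fs)) →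
  ∀ fs → F fs ≡ minOver w P fs
minOver-unique w P F F[] F∷ []       = F[]
minOver-unique w P F F[] F∷ (f ∷ fs) rewrite F∷ f fs | minOver-unique w P F F[] F∷ fs = refl

minCut-unfold : (w : Fin m → ℕ) (P : (Fin m → Side) → Bool) →
  minCut w P ≡ minOver w P (assignments m)
minCut-unfold {m} w P = unfold
  where
  -- minCut folds over assignments m with a local function that cannot be named;
  -- localFold is solved to it by unification in the with-clause of unfold.
  localFold : List (Fin m → Side) → ℕ∞
  localFold = _
  localFold≡minOver : ∀ fs → localFold fs ≡ minOver w P fs
  localFold≡minOver = minOver-unique w P localFold refl (λ _ _ → refl)
  unfold : minCut w P ≡ minOver w P (assignments m)
  unfold with assignments m
  ... | fs = localFold≡minOver fs

Attained : (Fin m → ℕ) → ((Fin m → Side) → Bool) → ℕ∞ → Set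
Attained w P x = ∃[ f ] T (P f) × x ≡ fin (cutWeight w f)

minOver-attained : (w : Fin m → ℕ) (P : (Fin m → Side) → Bool) (fs : List (Fin m → Side)) →
  minOver w P fs ≡ ∞ ⊎ Attained w P (minOver w P fs)
minOver-attained w P []       = inj₁ refl
minOver-attained w P (f ∷ fs) with P f in Pf
... | false = minOver-attained w P fs
... | true with min∞-sel (cutWeight w f) (minOver w P fs)
...   | inj₁ ≡f    = inj₂ (f , from T-≡ Pf , ≡f)
...   | inj₂ ≡rest rewrite ≡rest = minOver-attained w P fs

minOver-≤ : (w : Fin m → ℕ) (P : (Fin m → Side) → Bool) {f : Fin m → Side}
  (fs : List (Fin m → Side)) → f ∈ fs → T (P f) → minOver w P fs ≤∞ fin (cutWeight w f)
minOver-≤ w P (f ∷ fs) (here refl) Pf rewrite to T-≡ Pf = min∞-≤ˡ (cutWeight w f) (minOver w P fs)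
minOver-≤ w P (g ∷ fs) (there f∈fs) Pf with P g
... | false = minOver-≤ w P fs f∈fs Pf
... | true  = ≤∞-trans (min∞-≤ʳ (cutWeight w g) (minOver w P fs)) (minOver-≤ w P fs f∈fs Pf)

assignments-complete : (f : Fin m → Side) → ∃[ g ] g ∈ assignments m × g ≗ f
assignments-complete {zero}  f = (λ ()) , here refl , (λ ())
assignments-complete {suc m} f =
  let g , g∈ , g≗ = assignments-complete (f ∘ suc)
  in cons (f zero) g , ∈-concat⁺′ (∈-map⁺ (λ s → cons s g) (side∈ (f zero))) (∈-map⁺ _ g∈) , extend g≗
  where
  side∈ : (s : Side) → s ∈ L ∷ S ∷ R ∷ []
  side∈ L = here refl
  side∈ S = there (here refl)
  side∈ R = there (there (here refl))
  extend : {g : Fin m → Side} → g ≗ f ∘ suc → cons (f zero) g ≗ f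
  extend g≗ zero    = refl
  extend g≗ (suc i) = g≗ i

minCut-attained : (w : Fin m → ℕ) (P : (Fin m → Side) → Bool) →
  minCut w P ≡ ∞ ⊎ Attained w P (minCut w P)
minCut-attained {m} w P rewrite minCut-unfold w P = minOver-attained w P (assignments m)

minCut-≤ : (w : Fin m → ℕ) {P : (Fin m → Side) → Bool} → P Preserves _≗_ ⟶ _≡_ →
  {f : Fin m → Side} → T (P f) → minCut w P ≤∞ fin (cutWeight w f)
minCut-≤ {m} w {P} P-cong {f} Pf rewrite minCut-unfold w P =
  let g , g∈ , g≗f = assignments-complete f
  in subst (λ k → minOver w P (assignments m) ≤∞ fin k) (cutWeight-cong w g≗f)
       (minOver-≤ w P (assignments m) g∈ (subst T (sym (P-cong g≗f)) Pf))

minCut-mono : {m′ : ℕ} (w : Fin m → ℕ) (w′ : Fin m′ → ℕ)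
  {P : (Fin m → Side) → Bool} {Q : (Fin m′ → Side) → Bool} → Q Preserves _≗_ ⟶ _≡_ → (a b : ℕ) →
  (∀ f → T (P f) → ∃[ g ] T (Q g) × cutWeight w′ g + a ≤ cutWeight w f + b) →
  minCut w′ Q +∞ a ≤∞ minCut w P +∞ b
minCut-mono w w′ {P} {Q} Q-cong a b simulate with minCut w P | minCut-attained w P
... | _ | inj₁ refl = _ ≤∞∞
... | _ | inj₂ (f , Pf , refl) =
  let g , Qg , ≤f = simulate f Pf
  in ≤∞-trans (+∞-monoˡ-≤ a (minCut-≤ w′ Q-cong Qg)) (fin≤fin ≤f)

minCut-shift : {m′ : ℕ} (w : Fin m → ℕ) (w′ : Fin m′ → ℕ)
  {P : (Fin m → Side) → Bool} {Q : (Fin m′ → Side) → Bool} →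
  P Preserves _≗_ ⟶ _≡_ → Q Preserves _≗_ ⟶ _≡_ → (c : ℕ) →
  (∀ f → T (P f) → ∃[ g ] T (Q g) × cutWeight w′ g ≡ cutWeight w f + c) →
  (∀ g → T (Q g) → ∃[ f ] T (P f) × cutWeight w′ g ≡ cutWeight w f + c) →
  minCut w′ Q ≡ minCut w P +∞ c
minCut-shift w w′ P-cong Q-cong c forward backward =
  trans (sym (+∞-identityʳ _)) (≤∞-antisym
    (minCut-mono w w′ Q-cong 0 c λ f Pf →
      let g , Qg , g≡f = forward f Pf in g , Qg , ≤-reflexive (trans (+-identityʳ _) g≡f))
    (minCut-mono w′ w P-cong c 0 λ g Qg →
      let f , Pf , g≡f = backward g Qg in f , Pf , ≤-reflexive (sym (trans (+-identityʳ _) g≡f))))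

κund-right : (E : Adj m) (w : Fin m → ℕ) (x : Fin m) →
  κund E w x ≡ minCut w (λ g → isUndCut E g ∧ isR (g x))
κund-right {m} E w x =
  trans (minCut-shift w w (anchored isR) (anchored isL) 0 forward backward) (+∞-identityʳ _)
  where
  anchored : (side : Side → Bool) → (λ g → isUndCut E g ∧ side (g x)) Preserves _≗_ ⟶ _≡_
  anchored side = ∧-preserves-≗ (isDirCut-cong (symmetrise E)) (at-preserves-≗ side x)
  swap-anchored : {side side′ : Side → Bool} → (∀ a → side′ (swapSide a) ≡ side a) → (f : Fin m → Side) →
    T (isUndCut E f ∧ side (f x)) → T (isUndCut E (swapSide ∘ f) ∧ side′ (swapSide (f x)))
  swap-anchored side′-swap f h =
    let cut , anchor = to (T-∧ {isUndCut E f}) h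
    in from (T-∧ {isUndCut E (swapSide ∘ f)})
         (from (T-isUndCut E) (swap-isCut E (to (T-isUndCut E) cut)) ,
          subst T (sym (side′-swap (f x))) anchor)
  cutWeight-swap : (f : Fin m → Side) → cutWeight w (swapSide ∘ f) ≡ cutWeight w f
  cutWeight-swap f = sumFin-cong (λ v → sideWeight-swapSide (f v) (w v))
  forward : ∀ f → T (isUndCut E f ∧ isR (f x)) →
    ∃[ g ] T (isUndCut E g ∧ isL (g x)) × cutWeight w g ≡ cutWeight w f + 0
  forward f h =
    swapSide ∘ f , swap-anchored {isR} {isL} isL-swapSide f h ,
    trans (cutWeight-swap f) (sym (+-identityʳ _))
  backward : ∀ g → T (isUndCut E g ∧ isL (g x)) →
    ∃[ f ] T (isUndCut E f ∧ isR (f x)) × cutWeight w g ≡ cutWeight w f + 0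
  backward g h =
    swapSide ∘ g , swap-anchored {isL} {isR} isR-swapSide g h ,
    trans (sym (cutWeight-swap g)) (sym (+-identityʳ _))

-- The split graph

data Copy (n : ℕ) : Fin (n + n) → Set where
  outCopy : (u : Fin n) → Copy n (vout u)
  inCopy  : (u : Fin n) → Copy n (vin u)

copy : (x : Fin (n + n)) → Copy n x
copy {n} x with splitAt n x in split≡
... | inj₁ u = subst (Copy n) (splitAt⁻¹-↑ˡ split≡) (outCopy u)
... | inj₂ u = subst (Copy n) (splitAt⁻¹-↑ʳ split≡) (inCopy u)

splitUnd : Adj n → Adj (n + n)
splitUnd E = symmetrise (splitAdj E)

split : (Fin n → Side) → Fin (n + n) → Side
split {n} f x = [ outSide ∘ f , inSide ∘ f ]′ (splitAt n x)

merge : (Fin (n + n) → Side) → Fin n → Side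
merge g u = mergeSide (g (vout u)) (g (vin u))

split-vout : (f : Fin n → Side) (u : Fin n) → split f (vout u) ≡ outSide (f u)
split-vout {n} f u rewrite splitAt-↑ˡ n u n = refl

split-vin : (f : Fin n → Side) (u : Fin n) → split f (vin u) ≡ inSide (f u)
split-vin {n} f u rewrite splitAt-↑ʳ n n u = refl

splitW-vout : (w : Fin n → ℕ) (u : Fin n) → splitW w (vout u) ≡ w u
splitW-vout {n} w u rewrite splitAt-↑ˡ n u n = refl

splitW-vin : (w : Fin n → ℕ) (u : Fin n) → splitW w (vin u) ≡ w u
splitW-vin {n} w u rewrite splitAt-↑ʳ n n u = refl

cutWeight-split : (w : Fin n → ℕ) (f : Fin n → Side) →
  cutWeight (splitW w) (split f) ≡ cutWeight w f + sumFin w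
cutWeight-split {n} w f = begin
  cutWeight (splitW w) (split f)
    ≡⟨ sumFin-↑ n n _ ⟩
  sumFin {n} (λ u → sideWeight (split f (vout u)) (splitW w (vout u)))
    + sumFin {n} (λ u → sideWeight (split f (vin u)) (splitW w (vin u)))
    ≡⟨ cong₂ _+_ (sumFin-cong {n} λ u → cong₂ sideWeight (split-vout f u) (splitW-vout w u))
                 (sumFin-cong {n} λ u → cong₂ sideWeight (split-vin f u) (splitW-vin w u)) ⟩
  sumFin (λ u → sideWeight (outSide (f u)) (w u)) + sumFin (λ u → sideWeight (inSide (f u)) (w u))
    ≡⟨ sumFin-distrib-+ (λ u → sideWeight (outSide (f u)) (w u)) (λ u → sideWeight (inSide (f u)) (w u))
     ⟨
  sumFin (λ u → sideWeight (outSide (f u)) (w u) + sideWeight (inSide (f u)) (w u))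
    ≡⟨ sumFin-cong {n} (λ u → sideWeight-outSide-inSide (f u) (w u)) ⟩
  sumFin (λ u → sideWeight (f u) (w u) + w u)
    ≡⟨ sumFin-distrib-+ (λ u → sideWeight (f u) (w u)) w ⟩
  cutWeight w f + sumFin w ∎
  where open ≡-Reasoning

-- Among cuts of G′, these are exactly the images split f (see split-merge).
record Compatible (g : Fin (n + n) → Side) : Set where
  field
    out≢R : (u : Fin n) → g (vout u) ≢ R
    in≢L  : (u : Fin n) → g (vin u) ≢ L

module _ {n : ℕ} (E : Adj n) where

  out-clique : {u v : Fin n} → u ≢ v → T (splitUnd E (vout u) (vout v))
  out-clique {u} {v} u≢v rewrite splitAt-↑ˡ n u n | splitAt-↑ˡ n v n =
    from T-∨ (inj₁ (fromWitnessFalse {a? = u ≟ v} u≢v))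

  in-clique : {u v : Fin n} → u ≢ v → T (splitUnd E (vin u) (vin v))
  in-clique {u} {v} u≢v rewrite splitAt-↑ʳ n n u | splitAt-↑ʳ n n v =
    from T-∨ (inj₁ (fromWitnessFalse {a? = u ≟ v} u≢v))

  T-splitUnd-out-in : {u v : Fin n} → T (splitUnd E (vout u) (vin v)) ⇔ (u ≡ v ⊎ T (E u v))
  T-splitUnd-out-in {u} {v} rewrite splitAt-↑ˡ n u n | splitAt-↑ʳ n n v | ∨-idem (eqB u v ∨ E u v) =
    mk⇔ (Sum.map₁ toWitness ∘ to T-∨) (from T-∨ ∘ Sum.map₁ fromWitness)

  split-isCut : {f : Fin n → Side} → IsCut E f → IsCut (splitUnd E) (split f)
  split-isCut {f} c = record
    { left      = let u , u∈L = left  in vout u , trans (split-vout f u) (cong outSide u∈L)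
    ; right     = let v , v∈R = right in vin v  , trans (split-vin f v) (cong inSide v∈R)
    ; separated = λ {x} {y} → separated′ (copy x) (copy y)
    }
    where
    open IsCut c
    separated′ : ∀ {x y} → Copy n x → Copy n y → split f x ≡ L → split f y ≡ R → ¬ T (splitUnd E x y)
    separated′ (inCopy u)  _           x∈L _   =
      contradiction (trans (sym (split-vin f u)) x∈L) (inSide≢L (f u))
    separated′ (outCopy u) (outCopy v) _   y∈R =
      contradiction (trans (sym (split-vout f v)) y∈R) (outSide≢R (f v))
    separated′ (outCopy u) (inCopy v)  x∈L y∈R =
      [ (λ { refl → L≢R (trans (sym u∈L) v∈R) }) , separated u∈L v∈R ]′ ∘ to T-splitUnd-out-in
      where
      u∈L = outSide≡L⇒≡L (trans (sym (split-vout f u)) x∈L)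
      v∈R = inSide≡R⇒≡R (trans (sym (split-vin f v)) y∈R)

  split-isCut⁻ : {f : Fin n → Side} → IsCut (splitUnd E) (split f) → IsCut E f
  split-isCut⁻ {f} c = record
    { left      = let x , x∈L = left  in left′ (copy x) x∈L
    ; right     = let y , y∈R = right in right′ (copy y) y∈R
    ; separated = λ {u} {v} u∈L v∈R uv →
        separated (trans (split-vout f u) (cong outSide u∈L)) (trans (split-vin f v) (cong inSide v∈R))
                  (from T-splitUnd-out-in (inj₂ uv))
    }
    where
    open IsCut c
    left′ : ∀ {x} → Copy n x → split f x ≡ L → ∃[ u ] f u ≡ L
    left′ (outCopy u) x∈L = u , outSide≡L⇒≡L (trans (sym (split-vout f u)) x∈L)
    left′ (inCopy u)  x∈L = contradiction (trans (sym (split-vin f u)) x∈L) (inSide≢L (f u))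
    right′ : ∀ {y} → Copy n y → split f y ≡ R → ∃[ v ] f v ≡ R
    right′ (outCopy v) y∈R = contradiction (trans (sym (split-vout f v)) y∈R) (outSide≢R (f v))
    right′ (inCopy v)  y∈R = v , inSide≡R⇒≡R (trans (sym (split-vin f v)) y∈R)

  split-merge : {g : Fin (n + n) → Side} → IsCut (splitUnd E) g → Compatible {n} g →
    split (merge {n} g) ≗ g
  split-merge {g} c comp x with copy {n} x
  ... | outCopy u =
    trans (split-vout (merge g) u) (outSide-mergeSide (g (vin u)) (Compatible.out≢R comp u))
  ... | inCopy u  =
    trans (split-vin (merge g) u) (inSide-mergeSide (g (vout u)) (Compatible.in≢L comp u)
      λ u∈L u∈R → IsCut.separated c u∈L u∈R (from T-splitUnd-out-in (inj₁ refl)))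

  compatible-out-L : {g : Fin (n + n) → Side} {s : Fin n} → IsCut (splitUnd E) g → g (vout s) ≡ L →
    Compatible {n} g
  compatible-out-L {g} c s∈L =
    record { out≢R = out≢R ; in≢L = let y , y∈R = IsCut.right c in in≢L (copy y) y∈R }
    where
    out≢R : (u : Fin n) → g (vout u) ≢ R
    out≢R u = clique-not-LR c out-clique s∈L
    in≢L : ∀ {y} → Copy n y → g y ≡ R → (u : Fin n) → g (vin u) ≢ L
    in≢L (outCopy r) r∈R       = contradiction r∈R (out≢R r)
    in≢L (inCopy r)  r∈R u u∈L = clique-not-LR c in-clique u∈L r∈R

  compatible-in-R : {g : Fin (n + n) → Side} {t : Fin n} → IsCut (splitUnd E) g → g (vin t) ≡ R →
    Compatible {n} g
  compatible-in-R {g} c t∈R =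
    record { out≢R = let x , x∈L = IsCut.left c in out≢R (copy x) x∈L ; in≢L = in≢L }
    where
    in≢L : (u : Fin n) → g (vin u) ≢ L
    in≢L u u∈L = clique-not-LR c in-clique u∈L t∈R
    out≢R : ∀ {x} → Copy n x → g x ≡ L → (u : Fin n) → g (vout u) ≢ R
    out≢R (outCopy r) r∈L u u∈R = clique-not-LR c out-clique r∈L u∈R
    out≢R (inCopy r)  r∈L       = contradiction r∈L (in≢L r)

  minCut-split : (w : Fin n → ℕ) {P : (Fin n → Side) → Bool} {Q : (Fin (n + n) → Side) → Bool} →
    P Preserves _≗_ ⟶ _≡_ → Q Preserves _≗_ ⟶ _≡_ → (∀ f → Q (split f) ≡ P f) →
    (∀ g → IsCut (splitUnd E) g → T (Q g) → Compatible {n} g) →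
    minCut (splitW w) (λ g → isUndCut (splitAdj E) g ∧ Q g)
      ≡ minCut w (λ f → isDirCut E f ∧ P f) +∞ sumFin w
  minCut-split w {P} {Q} P-cong Q-cong Q∘split compatible =
    minCut-shift w (splitW w) (∧-preserves-≗ (isDirCut-cong E) P-cong)
      (∧-preserves-≗ (isDirCut-cong (splitUnd E)) Q-cong) (sumFin w) forward backward
    where
    forward : ∀ f → T (isDirCut E f ∧ P f) →
      ∃[ g ] T (isUndCut (splitAdj E) g ∧ Q g) × cutWeight (splitW w) g ≡ cutWeight w f + sumFin w
    forward f h with to (T-∧ {isDirCut E f}) h
    ... | cut , Pf = split f ,
      from (T-∧ {isUndCut (splitAdj E) (split f)})
        (from (T-isUndCut (splitAdj E)) (split-isCut (to T-isDirCut cut)) , subst T (sym (Q∘split f)) Pf) ,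
      cutWeight-split w f
    backward : ∀ g → T (isUndCut (splitAdj E) g ∧ Q g) →
      ∃[ f ] T (isDirCut E f ∧ P f) × cutWeight (splitW w) g ≡ cutWeight w f + sumFin w
    backward g h with to (T-∧ {isUndCut (splitAdj E) g}) h
    ... | cut , Qg = merge {n} g ,
      from (T-∧ {isDirCut E (merge {n} g)}) (from T-isDirCut (split-isCut⁻ merged-isCut) , P-merged) ,
      trans (sym (cutWeight-cong (splitW w) split∘merge≗)) (cutWeight-split w (merge {n} g))
      where
      isCut : IsCut (splitUnd E) g
      isCut = to (T-isUndCut (splitAdj E)) cut
      split∘merge≗ : split (merge {n} g) ≗ g
      split∘merge≗ = split-merge isCut (compatible g isCut Qg)
      merged-isCut : IsCut (splitUnd E) (split (merge {n} g))
      merged-isCut =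
        to (T-isUndCut (splitAdj E)) (subst T (sym (isDirCut-cong (splitUnd E) split∘merge≗)) cut)
      P-merged : T (P (merge {n} g))
      P-merged = subst T (trans (sym (Q-cong split∘merge≗)) (Q∘split (merge {n} g))) Qg

κund-vout : {n : ℕ} (E : Adj n) (w : Fin n → ℕ) (s : Fin n) →
  κund (splitAdj E) (splitW w) (vout s) ≡ κsrc E w s +∞ sumFin w
κund-vout E w s =
  minCut-split E w (at-preserves-≗ isL s) (at-preserves-≗ isL (vout s))
    (λ f → trans (cong isL (split-vout f s)) (isL-outSide (f s)))
    (λ g c s∈L → compatible-out-L E c (to T-isL s∈L))

κund-vin : {n : ℕ} (E : Adj n) (w : Fin n → ℕ) (t : Fin n) →
  κund (splitAdj E) (splitW w) (vin t) ≡ κsnk E w t +∞ sumFin w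
κund-vin E w t =
  trans (κund-right (splitAdj E) (splitW w) (vin t))
    (minCut-split E w (at-preserves-≗ isR t) (at-preserves-≗ isR (vin t))
      (λ f → trans (cong isR (split-vin f t)) (isR-inSide (f t)))
      (λ g c t∈R → compatible-in-R E c (to T-isR t∈R)))

corollary3p7 : (n : ℕ) (E : Fin n → Fin n → Bool) (w : Fin n → ℕ) →
    (∀ v → 0 < w v) →
    (∀ s t →
      (κund (splitAdj E) (splitW w) (vout s) ≡ κsrc E w s +∞ sumFin w) ×
      (κund (splitAdj E) (splitW w) (vin t) ≡ κsnk E w t +∞ sumFin w))
-- The weights need not be positive.
corollary3p7 n E w _ s t = κund-vout E w s , κund-vin E w t
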